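{- If $M_1$ and $M_2$ are matroids and $k$ is a positive integer, then $$T^k_{M_1\oplus M_2}((x_i);(y_i))=T^k_{M_1}((x_i);(y_i))\,T^k_{M_2}((x_i);(y_i)).$$
   Context: For a matroid $M$ on ground set $\mathcal{A}$ with rank function $\mathrm{rk}$, $T^k_M((x_i)_1^k;(y_i)_1^k)=\sum_{S_1\subseteq\cdots\subseteq S_k\subseteq\mathcal{A}}\prod_{i=1}^k(x_i-1)^{\mathrm{rk}(\mathcal{A})-\mathrm{rk}(S_i)}(y_i-1)^{|S_i|-\mathrm{rk}(S_i)}$ (sum over weakly increasing chains of $k$ subsets). The direct sum $M_1\oplus M_2$ of matroids on disjoint ground sets $\mathcal{A}_1,\mathcal{A}_2$ has ground set $\mathcal{A}_1\sqcup\mathcal{A}_2$ and independent sets $I_1\sqcup I_2$ with $I_j$ independent in $M_j$; equivalently $\mathrm{rk}(X_1\sqcup X_2)=\mathrm{rk}_{M_1}(X_1)+\mathrm{rk}_{M_2}(X_2)$. -}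

module Defs where

open import Level using (Level; _⊔_)
open import Data.Nat using (ℕ; zero; suc; _+_; _∸_; _≤_)
open import Data.Nat as ℕ using ()
open import Data.Nat.Properties using (+-mono-≤; ≤-reflexive; +-suc; ≤-trans; +-comm; +-assoc)
open import Data.Bool using (_∨_; _∧_)
open import Data.Fin using (Fin; zero; suc)
open import Data.Fin.Subset using (Subset; Side; inside; outside; _⊆_; _∪_; _∩_; ∣_∣; _∈_) renaming (⊤ to full)
open import Data.Fin.Subset.Properties using (_⊆?_; drop-∷-⊆)
open import Data.Vec using (Vec; []; _∷_; take; drop)
open import Data.Vec.Properties using (take-zipWith; drop-zipWith)
open import Data.List using (List; []; _∷_; concatMap; map; filter; foldr)
open import Data.Product using (_×_; _,_)
open import Data.Unit using (⊤; tt)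
open import Relation.Nullary using (Dec; yes; no)
open import Relation.Nullary.Decidable using (_×-dec_)
open import Relation.Binary.PropositionalEquality using (_≡_; refl; cong; sym; subst)
open import Data.Vec.Base using (_[_]=_; here; there)
open import Algebra.Bundles using (CommutativeRing)
import Algebra.Bundles
import Algebra.Definitions.RawSemiring as RS

record Matroid (n : ℕ) : Set where
  field
    rk        : Subset n → ℕ
    rk-bound  : ∀ X → rk X ≤ ∣ X ∣                           -- R1 (0 ≤ rk is automatic in ℕ)
    rk-mono   : ∀ {X Y} → X ⊆ Y → rk X ≤ rk Y
    rk-submod : ∀ X Y → rk (X ∪ Y) + rk (X ∩ Y) ≤ rk X + rk Y

-- Direct sum: ground set Fin (n₁ + n₂) = A₁ ⊔ A₂ (first n₁ elements form A₁),
-- rk (X₁ ⊔ X₂) = rk₁ X₁ + rk₂ X₂.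

private
  ∣take∣+∣drop∣ : ∀ m {n} (X : Subset (m + n)) → ∣ take m X ∣ + ∣ drop m X ∣ ≡ ∣ X ∣
  ∣take∣+∣drop∣ zero X = refl
  ∣take∣+∣drop∣ (suc m) (inside ∷ X) = cong suc (∣take∣+∣drop∣ m X)
  ∣take∣+∣drop∣ (suc m) (outside ∷ X) = ∣take∣+∣drop∣ m X

  ∷-⊆ : ∀ {k} {s t : Side} {A B : Subset k} →
        (s ≡ inside → t ≡ inside) → A ⊆ B → (s ∷ A) ⊆ (t ∷ B)
  ∷-⊆ h A⊆B {zero} here with h refl
  ... | refl = here
  ∷-⊆ h A⊆B {suc x} (there p) = there (A⊆B p)

  head-⊆ : ∀ {k} {s t : Side} {A B : Subset k} → (s ∷ A) ⊆ (t ∷ B) → s ≡ inside → t ≡ inside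
  head-⊆ sub refl with sub here
  ... | here = refl

  take-⊆ : ∀ m {n} {X Y : Subset (m + n)} → X ⊆ Y → take m X ⊆ take m Y
  take-⊆ zero sub ()
  take-⊆ (suc m) {X = s ∷ X} {t ∷ Y} sub = ∷-⊆ (head-⊆ sub) (take-⊆ m (drop-∷-⊆ sub))

  drop-⊆ : ∀ m {n} {X Y : Subset (m + n)} → X ⊆ Y → drop m X ⊆ drop m Y
  drop-⊆ zero sub = sub
  drop-⊆ (suc m) {X = s ∷ X} {t ∷ Y} sub = drop-⊆ m (drop-∷-⊆ sub)

  interchange : ∀ a b c d → (a + b) + (c + d) ≡ (a + c) + (b + d)
  interchange a b c d rewrite +-assoc a b (c + d) | +-assoc a c (b + d)
    | sym (+-assoc b c d) | +-comm b c | +-assoc c b d = refl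

_⊕_ : ∀ {n₁ n₂} → Matroid n₁ → Matroid n₂ → Matroid (n₁ + n₂)
_⊕_ {n₁} {n₂} M₁ M₂ = record
  { rk        = rk⊕
  ; rk-bound  = λ X → subst (rk⊕ X ≤_) (∣take∣+∣drop∣ n₁ X)
                  (+-mono-≤ (M₁.rk-bound (take n₁ X)) (M₂.rk-bound (drop n₁ X)))
  ; rk-mono   = λ sub → +-mono-≤ (M₁.rk-mono (take-⊆ n₁ sub)) (M₂.rk-mono (drop-⊆ n₁ sub))
  ; rk-submod = submod
  }
  where
  module M₁ = Matroid M₁
  module M₂ = Matroid M₂
  rk⊕ : Subset (n₁ + n₂) → ℕ
  rk⊕ X = M₁.rk (take n₁ X) + M₂.rk (drop n₁ X)
  submod : ∀ X Y → rk⊕ (X ∪ Y) + rk⊕ (X ∩ Y) ≤ rk⊕ X + rk⊕ Y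
  submod X Y
    rewrite take-zipWith {m = n₁} _∨_ X Y
          | drop-zipWith {m = n₁} _∨_ X Y
          | take-zipWith {m = n₁} _∧_ X Y
          | drop-zipWith {m = n₁} _∧_ X Y
          | interchange (M₁.rk (take n₁ X ∪ take n₁ Y)) (M₂.rk (drop n₁ X ∪ drop n₁ Y))
                        (M₁.rk (take n₁ X ∩ take n₁ Y)) (M₂.rk (drop n₁ X ∩ drop n₁ Y))
          | interchange (M₁.rk (take n₁ X)) (M₂.rk (drop n₁ X))
                        (M₁.rk (take n₁ Y)) (M₂.rk (drop n₁ Y))
    = +-mono-≤ (M₁.rk-submod (take n₁ X) (take n₁ Y)) (M₂.rk-submod (drop n₁ X) (drop n₁ Y))

allSubsets : (n : ℕ) → List (Subset n)
allSubsets zero    = [] ∷ []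
allSubsets (suc n) = concatMap (λ X → (inside ∷ X) ∷ (outside ∷ X) ∷ []) (allSubsets n)

allTuples : (k n : ℕ) → List (Vec (Subset n) k)
allTuples zero    n = [] ∷ []
allTuples (suc k) n = concatMap (λ S → map (S ∷_) (allTuples k n)) (allSubsets n)

IsChain : ∀ {k n} → Vec (Subset n) k → Set
IsChain []           = ⊤
IsChain (S ∷ [])     = ⊤
IsChain (S ∷ T ∷ Ss) = S ⊆ T × IsChain (T ∷ Ss)

isChain? : ∀ {k n} (Ss : Vec (Subset n) k) → Dec (IsChain Ss)
isChain? []           = yes tt
isChain? (S ∷ [])     = yes tt
isChain? (S ∷ T ∷ Ss) = (S ⊆? T) ×-dec isChain? (T ∷ Ss)

chains : (k n : ℕ) → List (Vec (Subset n) k)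
chains k n = filter isChain? (allTuples k n)

-- The k-th Tutte polynomial, evaluated at x, y : Fin k → R in an arbitrary
-- commutative ring R (a polynomial identity over ℤ is equivalent to its
-- validity for all such evaluations).

module _ {c ℓ : Level} (R : CommutativeRing c ℓ) where
  open CommutativeRing R using (Carrier; _*_; _-_; 0#; 1#; semiring) renaming (_+_ to _+ᴿ_)
  open RS (Algebra.Bundles.Semiring.rawSemiring semiring) using (_^_)

  ∏Fin : (k : ℕ) → (Fin k → Carrier) → Carrier
  ∏Fin zero    f = 1#
  ∏Fin (suc k) f = f zero * ∏Fin k (λ i → f (suc i))

  ∑List : ∀ {a} {A : Set a} → (A → Carrier) → List A → Carrier
  ∑List f = foldr (λ a acc → f a +ᴿ acc) 0#

  lookupV : ∀ {a} {A : Set a} {k} → Vec A k → Fin k → A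
  lookupV (a ∷ as) zero    = a
  lookupV (a ∷ as) (suc i) = lookupV as i

  Tutte : ∀ {n} (k : ℕ) → Matroid n → (Fin k → Carrier) → (Fin k → Carrier) → Carrier
  Tutte {n} k M x y = ∑List term (chains k n)
    where
    open Matroid M
    term : Vec (Subset n) k → Carrier
    term Ss = ∏Fin k (λ i →
      ((x i - 1#) ^ (rk full ∸ rk (lookupV Ss i)))
      * ((y i - 1#) ^ (∣ lookupV Ss i ∣ ∸ rk (lookupV Ss i))))

-- A subset of A₁ ⊔ A₂ is a pair of subsets (X₁, X₂), and a k-tuple of such subsets is a
-- chain exactly when both of its projections are chains.  Rank and cardinality are additive
-- over the direct sum, hence so are corank and nullity, so the monomial of a chain of
-- M₁ ⊕ M₂ is the product of the monomials of its two projections.  The sum over all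
-- k-tuples of subsets of A₁ ⊔ A₂ is a double sum over pairs of k-tuples, which factors.
module Submission where

open import Defs
open import Level using (Level)
open import Data.Nat using (ℕ; _≤_)
open import Data.Fin using (Fin)
import Data.Fin as Fin
open import Algebra.Bundles using (CommutativeRing)

open import Data.Nat using (zero; suc; _∸_)
import Data.Nat as ℕ
open import Data.Nat.Properties using (∸-+-assoc; +-∸-comm; +-∸-assoc)
open import Data.Bool using (Bool; true; false; _∧_)
open import Data.Fin.Subset using (Subset; Side; inside; outside; _⊆_; ∣_∣; ⊤)
open import Data.Fin.Subset.Properties using (drop-∷-⊆; out⊆; in⊆in; ⊆⊤)
open import Data.Vec using (Vec; []; _∷_; take; drop; replicate; map)
open import Data.Vec.Base using (here)
open import Data.List using (List; []; _∷_; _++_; concatMap; filter)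
import Data.List as List
open import Data.Product using (_×_; _,_)
open import Data.Unit using (tt)
open import Function using (mk⇔)
open import Relation.Nullary using (Dec; does; contradiction)
open import Relation.Nullary.Decidable using (does-⇔; _×-dec_)
open import Relation.Binary.PropositionalEquality as ≡ using (_≡_; refl; cong; cong₂)
import Algebra.Properties.Semiring.Exp as Exp
import Algebra.Properties.CommutativeSemigroup as CommutativeSemigroupProperties
import Relation.Binary.Reasoning.Setoid as SetoidReasoning

private
  variable
    a b : Level
    A : Set a
    B : Set b
    k m n : ℕ

[m+n]∸[o+p]≡[m∸o]+[n∸p] : ∀ m n o p → o ≤ m → p ≤ n → (m ℕ.+ n) ∸ (o ℕ.+ p) ≡ (m ∸ o) ℕ.+ (n ∸ p)
[m+n]∸[o+p]≡[m∸o]+[n∸p] m n o p o≤m p≤n = begin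
  (m ℕ.+ n) ∸ (o ℕ.+ p)  ≡⟨ ∸-+-assoc (m ℕ.+ n) o p ⟨
  (m ℕ.+ n) ∸ o ∸ p      ≡⟨ cong (_∸ p) (+-∸-comm n o≤m) ⟩
  (m ∸ o ℕ.+ n) ∸ p      ≡⟨ +-∸-assoc (m ∸ o) p≤n ⟩
  (m ∸ o) ℕ.+ (n ∸ p)    ∎
  where open ≡.≡-Reasoning

take-replicate : ∀ m (x : A) → take m (replicate (m ℕ.+ n) x) ≡ replicate m x
take-replicate zero    x = refl
take-replicate (suc m) x = cong (x ∷_) (take-replicate m x)

drop-replicate : ∀ m (x : A) → drop m (replicate (m ℕ.+ n) x) ≡ replicate n x
drop-replicate zero    x = refl
drop-replicate (suc m) x = drop-replicate m x

∣take∣+∣drop∣≡∣p∣ : ∀ m (p : Subset (m ℕ.+ n)) → ∣ take m p ∣ ℕ.+ ∣ drop m p ∣ ≡ ∣ p ∣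
∣take∣+∣drop∣≡∣p∣ zero    p             = refl
∣take∣+∣drop∣≡∣p∣ (suc m) (inside ∷ p)  = cong suc (∣take∣+∣drop∣≡∣p∣ m p)
∣take∣+∣drop∣≡∣p∣ (suc m) (outside ∷ p) = ∣take∣+∣drop∣≡∣p∣ m p

∷⊆∷-replace-tails : ∀ {s t : Side} {p q : Subset m} {p′ q′ : Subset n} →
             s ∷ p ⊆ t ∷ q → p′ ⊆ q′ → s ∷ p′ ⊆ t ∷ q′
∷⊆∷-replace-tails {s = outside}               _     = out⊆
∷⊆∷-replace-tails {s = inside} {t = inside}   _     = in⊆in
∷⊆∷-replace-tails {s = inside} {t = outside}  sp⊆tq = contradiction (sp⊆tq here) λ ()

take-⊆ : ∀ m {p q : Subset (m ℕ.+ n)} → p ⊆ q → take m p ⊆ take m q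
take-⊆ zero    _ ()
take-⊆ (suc m) {_ ∷ _} {_ ∷ _} p⊆q = ∷⊆∷-replace-tails p⊆q (take-⊆ m (drop-∷-⊆ p⊆q))

drop-⊆ : ∀ m {p q : Subset (m ℕ.+ n)} → p ⊆ q → drop m p ⊆ drop m q
drop-⊆ zero    p⊆q = p⊆q
drop-⊆ (suc m) {_ ∷ _} {_ ∷ _} p⊆q = drop-⊆ m (drop-∷-⊆ p⊆q)

take-drop-⊆ : ∀ m {p q : Subset (m ℕ.+ n)} → take m p ⊆ take m q → drop m p ⊆ drop m q → p ⊆ q
take-drop-⊆ zero    _     d⊆d = d⊆d
take-drop-⊆ (suc m) {_ ∷ _} {_ ∷ _} t⊆t d⊆d =
  ∷⊆∷-replace-tails t⊆t (take-drop-⊆ m (drop-∷-⊆ t⊆t) d⊆d)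

IsChain-take-drop : ∀ m (Ss : Vec (Subset (m ℕ.+ n)) k) →
                    IsChain Ss → IsChain (map (take m) Ss) × IsChain (map (drop m) Ss)
IsChain-take-drop m []           _           = tt , tt
IsChain-take-drop m (S ∷ [])     _           = tt , tt
IsChain-take-drop m (S ∷ T ∷ Ss) (S⊆T , c) with IsChain-take-drop m (T ∷ Ss) c
... | cᵗ , cᵈ = (take-⊆ m S⊆T , cᵗ) , (drop-⊆ m S⊆T , cᵈ)

IsChain-from-take-drop : ∀ m (Ss : Vec (Subset (m ℕ.+ n)) k) →
                         IsChain (map (take m) Ss) × IsChain (map (drop m) Ss) → IsChain Ss
IsChain-from-take-drop m []           _ = tt
IsChain-from-take-drop m (S ∷ [])     _ = tt
IsChain-from-take-drop m (S ∷ T ∷ Ss) ((t⊆t , cᵗ) , (d⊆d , cᵈ)) =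
  take-drop-⊆ m t⊆t d⊆d , IsChain-from-take-drop m (T ∷ Ss) (cᵗ , cᵈ)

isChain?-take-drop : ∀ m (Ss : Vec (Subset (m ℕ.+ n)) k) →
  does (isChain? Ss) ≡ does (isChain? (map (take m) Ss)) ∧ does (isChain? (map (drop m) Ss))
isChain?-take-drop m Ss =
  does-⇔ (mk⇔ (IsChain-take-drop m Ss) (IsChain-from-take-drop m Ss))
         (isChain? Ss) (isChain? (map (take m) Ss) ×-dec isChain? (map (drop m) Ss))

corank : Matroid n → Subset n → ℕ
corank M S = rk ⊤ ∸ rk S
  where open Matroid M

nullity : Matroid n → Subset n → ℕ
nullity M S = ∣ S ∣ ∸ rk S
  where open Matroid M

module _ {n₁ n₂ : ℕ} (M₁ : Matroid n₁) (M₂ : Matroid n₂) where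
  private
    module M₁ = Matroid M₁
    module M₂ = Matroid M₂

  rk-⊕-⊤ : Matroid.rk (M₁ ⊕ M₂) ⊤ ≡ M₁.rk ⊤ ℕ.+ M₂.rk ⊤
  rk-⊕-⊤ = cong₂ ℕ._+_ (cong M₁.rk (take-replicate n₁ inside)) (cong M₂.rk (drop-replicate n₁ inside))

  corank-⊕ : ∀ S → corank (M₁ ⊕ M₂) S ≡ corank M₁ (take n₁ S) ℕ.+ corank M₂ (drop n₁ S)
  corank-⊕ S = begin
    Matroid.rk (M₁ ⊕ M₂) ⊤ ∸ (M₁.rk S₁ ℕ.+ M₂.rk S₂)
      ≡⟨ cong (_∸ (M₁.rk S₁ ℕ.+ M₂.rk S₂)) rk-⊕-⊤ ⟩
    (M₁.rk ⊤ ℕ.+ M₂.rk ⊤) ∸ (M₁.rk S₁ ℕ.+ M₂.rk S₂)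
      ≡⟨ [m+n]∸[o+p]≡[m∸o]+[n∸p] _ _ _ _ (M₁.rk-mono ⊆⊤) (M₂.rk-mono ⊆⊤) ⟩
    corank M₁ S₁ ℕ.+ corank M₂ S₂ ∎
    where
    open ≡.≡-Reasoning
    S₁ : Subset n₁
    S₁ = take n₁ S
    S₂ : Subset n₂
    S₂ = drop n₁ S

  nullity-⊕ : ∀ S → nullity (M₁ ⊕ M₂) S ≡ nullity M₁ (take n₁ S) ℕ.+ nullity M₂ (drop n₁ S)
  nullity-⊕ S = begin
    ∣ S ∣ ∸ (M₁.rk S₁ ℕ.+ M₂.rk S₂)
      ≡⟨ cong (_∸ (M₁.rk S₁ ℕ.+ M₂.rk S₂)) (∣take∣+∣drop∣≡∣p∣ n₁ S) ⟨
    (∣ S₁ ∣ ℕ.+ ∣ S₂ ∣) ∸ (M₁.rk S₁ ℕ.+ M₂.rk S₂)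
      ≡⟨ [m+n]∸[o+p]≡[m∸o]+[n∸p] _ _ _ _ (M₁.rk-bound S₁) (M₂.rk-bound S₂) ⟩
    nullity M₁ S₁ ℕ.+ nullity M₂ S₂ ∎
    where
    open ≡.≡-Reasoning
    S₁ : Subset n₁
    S₁ = take n₁ S
    S₂ : Subset n₂
    S₂ = drop n₁ S

module _ {c ℓ : Level} (R : CommutativeRing c ℓ) where
  open CommutativeRing R hiding (zero) renaming (refl to ≈-refl)
  open Exp semiring using (_^_; ^-homo-*)
  open CommutativeSemigroupProperties *-commutativeSemigroup using (interchange)
  open SetoidReasoning setoid

  private
    ∑ : (A → Carrier) → List A → Carrier
    ∑ = ∑List R

  ∑-cong : {f g : A → Carrier} (xs : List A) → (∀ x → f x ≈ g x) → ∑ f xs ≈ ∑ g xs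
  ∑-cong []       f≈g = ≈-refl
  ∑-cong (x ∷ xs) f≈g = +-cong (f≈g x) (∑-cong xs f≈g)

  ∑-++ : ∀ (f : A → Carrier) xs ys → ∑ f (xs ++ ys) ≈ ∑ f xs + ∑ f ys
  ∑-++ f []       ys = sym (+-identityˡ _)
  ∑-++ f (x ∷ xs) ys = trans (+-congˡ (∑-++ f xs ys)) (sym (+-assoc _ _ _))

  ∑-concatMap : ∀ (f : B → Carrier) (h : A → List B) xs →
                ∑ f (concatMap h xs) ≈ ∑ (λ x → ∑ f (h x)) xs
  ∑-concatMap f h []       = ≈-refl
  ∑-concatMap f h (x ∷ xs) = trans (∑-++ f (h x) (concatMap h xs)) (+-congˡ (∑-concatMap f h xs))

  ∑-map : ∀ (f : B → Carrier) (h : A → B) xs → ∑ f (List.map h xs) ≈ ∑ (λ x → f (h x)) xs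
  ∑-map f h []       = ≈-refl
  ∑-map f h (x ∷ xs) = +-congˡ (∑-map f h xs)

  ∑-0# : ∀ (xs : List A) → ∑ (λ _ → 0#) xs ≈ 0#
  ∑-0# []       = ≈-refl
  ∑-0# (x ∷ xs) = trans (+-identityˡ _) (∑-0# xs)

  ∑-+ : ∀ (f g : A → Carrier) xs → ∑ (λ x → f x + g x) xs ≈ ∑ f xs + ∑ g xs
  ∑-+ f g []       = sym (+-identityˡ _)
  ∑-+ f g (x ∷ xs) = trans (+-congˡ (∑-+ f g xs))
                           (CommutativeSemigroupProperties.interchange +-commutativeSemigroup _ _ _ _)

  ∑-*ˡ : ∀ u (f : A → Carrier) xs → ∑ (λ x → u * f x) xs ≈ u * ∑ f xs
  ∑-*ˡ u f []       = sym (zeroʳ u)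
  ∑-*ˡ u f (x ∷ xs) = trans (+-congˡ (∑-*ˡ u f xs)) (sym (distribˡ u _ _))

  ∑-*ʳ : ∀ u (f : A → Carrier) xs → ∑ (λ x → f x * u) xs ≈ ∑ f xs * u
  ∑-*ʳ u f []       = sym (zeroˡ u)
  ∑-*ʳ u f (x ∷ xs) = trans (+-congˡ (∑-*ʳ u f xs)) (sym (distribʳ u _ _))

  ∑∑-* : ∀ (f : A → Carrier) (g : B → Carrier) xs ys →
         ∑ (λ x → ∑ (λ y → f x * g y) ys) xs ≈ ∑ f xs * ∑ g ys
  ∑∑-* f g xs ys = trans (∑-cong xs (λ x → ∑-*ˡ (f x) g ys)) (∑-*ʳ (∑ g ys) f xs)

  ∑-swap : ∀ (f : A → B → Carrier) xs ys →
           ∑ (λ x → ∑ (f x) ys) xs ≈ ∑ (λ y → ∑ (λ x → f x y) xs) ys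
  ∑-swap f []       ys = sym (∑-0# ys)
  ∑-swap f (x ∷ xs) ys = trans (+-congˡ (∑-swap f xs ys)) (sym (∑-+ (f x) _ ys))

  _when_ : Carrier → Bool → Carrier
  u when true  = u
  u when false = 0#

  when-congˡ : ∀ {u v} b → u ≈ v → u when b ≈ v when b
  when-congˡ true  u≈v = u≈v
  when-congˡ false _   = ≈-refl

  *-when-∧ : ∀ u v b₁ b₂ → (u * v) when (b₁ ∧ b₂) ≈ (u when b₁) * (v when b₂)
  *-when-∧ u v true  true  = ≈-refl
  *-when-∧ u v true  false = sym (zeroʳ u)
  *-when-∧ u v false b₂    = sym (zeroˡ _)

  ∑-filter : ∀ {P : A → Set b} (P? : ∀ x → Dec (P x)) (f : A → Carrier) xs →
             ∑ f (filter P? xs) ≈ ∑ (λ x → f x when does (P? x)) xs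
  ∑-filter P? f []       = ≈-refl
  ∑-filter P? f (x ∷ xs) with does (P? x)
  ... | true  = +-congˡ (∑-filter P? f xs)
  ... | false = trans (∑-filter P? f xs) (sym (+-identityˡ _))

  ∑-allSubsets-suc : ∀ n (f : Subset (suc n) → Carrier) →
    ∑ f (allSubsets (suc n)) ≈ ∑ (λ S → f (inside ∷ S) + f (outside ∷ S)) (allSubsets n)
  ∑-allSubsets-suc n f =
    trans (∑-concatMap f _ (allSubsets n)) (∑-cong (allSubsets n) (λ S → +-congˡ (+-identityʳ _)))

  ∑-allTuples-suc : ∀ k n (f : Vec (Subset n) (suc k) → Carrier) →
    ∑ f (allTuples (suc k) n) ≈ ∑ (λ S → ∑ (λ Ss → f (S ∷ Ss)) (allTuples k n)) (allSubsets n)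
  ∑-allTuples-suc k n f =
    trans (∑-concatMap f _ (allSubsets n)) (∑-cong (allSubsets n) (λ S → ∑-map f (S ∷_) (allTuples k n)))

  ∑-allSubsets-take-drop : ∀ m n (g : Subset m → Subset n → Carrier) →
    ∑ (λ S → g (take m S) (drop m S)) (allSubsets (m ℕ.+ n)) ≈
    ∑ (λ S₁ → ∑ (g S₁) (allSubsets n)) (allSubsets m)
  ∑-allSubsets-take-drop zero    n g = sym (+-identityʳ _)
  ∑-allSubsets-take-drop (suc m) n g = begin
    ∑ (λ S → g (take (suc m) S) (drop (suc m) S)) (allSubsets (suc m ℕ.+ n))
      ≈⟨ ∑-allSubsets-suc (m ℕ.+ n) _ ⟩
    ∑ (λ S → g′ (take m S) (drop m S)) (allSubsets (m ℕ.+ n))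
      ≈⟨ ∑-allSubsets-take-drop m n g′ ⟩
    ∑ (λ S₁ → ∑ (g′ S₁) (allSubsets n)) (allSubsets m)
      ≈⟨ ∑-cong (allSubsets m) (λ S₁ → ∑-+ (g (inside ∷ S₁)) (g (outside ∷ S₁)) (allSubsets n)) ⟩
    ∑ (λ S₁ → ∑ (g (inside ∷ S₁)) (allSubsets n) + ∑ (g (outside ∷ S₁)) (allSubsets n)) (allSubsets m)
      ≈⟨ ∑-allSubsets-suc m _ ⟨
    ∑ (λ S₁ → ∑ (g S₁) (allSubsets n)) (allSubsets (suc m)) ∎
    where
    g′ : Subset m → Subset n → Carrier
    g′ S₁ S₂ = g (inside ∷ S₁) S₂ + g (outside ∷ S₁) S₂

  ∑-allTuples-take-drop : ∀ k m n (f : Vec (Subset m) k → Vec (Subset n) k → Carrier) →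
    ∑ (λ Ss → f (map (take m) Ss) (map (drop m) Ss)) (allTuples k (m ℕ.+ n)) ≈
    ∑ (λ As → ∑ (f As) (allTuples k n)) (allTuples k m)
  ∑-allTuples-take-drop zero    m n f = sym (+-identityʳ _)
  ∑-allTuples-take-drop (suc k) m n f = begin
    ∑ (λ Ss → f (map (take m) Ss) (map (drop m) Ss)) (allTuples (suc k) (m ℕ.+ n))
      ≈⟨ ∑-allTuples-suc k (m ℕ.+ n) _ ⟩
    ∑ (λ S → ∑ (λ Ss → f (take m S ∷ map (take m) Ss) (drop m S ∷ map (drop m) Ss))
               (allTuples k (m ℕ.+ n))) (allSubsets (m ℕ.+ n))
      ≈⟨ ∑-cong (allSubsets (m ℕ.+ n)) (λ S →
           ∑-allTuples-take-drop k m n (λ As Bs → f (take m S ∷ As) (drop m S ∷ Bs))) ⟩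
    ∑ (λ S → g (take m S) (drop m S)) (allSubsets (m ℕ.+ n))
      ≈⟨ ∑-allSubsets-take-drop m n g ⟩
    ∑ (λ S₁ → ∑ (g S₁) (allSubsets n)) (allSubsets m)
      ≈⟨ ∑-cong (allSubsets m) (λ S₁ → ∑-swap _ (allSubsets n) (allTuples k m)) ⟩
    ∑ (λ S₁ → ∑ (λ As → ∑ (λ S₂ → ∑ (λ Bs → f (S₁ ∷ As) (S₂ ∷ Bs)) (allTuples k n))
                          (allSubsets n)) (allTuples k m)) (allSubsets m)
      ≈⟨ ∑-cong (allSubsets m) (λ S₁ → ∑-cong (allTuples k m) (λ As →
           ∑-allTuples-suc k n (f (S₁ ∷ As)))) ⟨
    ∑ (λ S₁ → ∑ (λ As → ∑ (f (S₁ ∷ As)) (allTuples (suc k) n)) (allTuples k m)) (allSubsets m)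
      ≈⟨ ∑-allTuples-suc k m _ ⟨
    ∑ (λ As → ∑ (f As) (allTuples (suc k) n)) (allTuples (suc k) m) ∎
    where
    g : Subset m → Subset n → Carrier
    g S₁ S₂ = ∑ (λ As → ∑ (λ Bs → f (S₁ ∷ As) (S₂ ∷ Bs)) (allTuples k n)) (allTuples k m)

  ∏Fin-cong : ∀ k {f g : Fin k → Carrier} → (∀ i → f i ≈ g i) → ∏Fin R k f ≈ ∏Fin R k g
  ∏Fin-cong zero    f≈g = ≈-refl
  ∏Fin-cong (suc k) f≈g = *-cong (f≈g Fin.zero) (∏Fin-cong k (λ i → f≈g (Fin.suc i)))

  ∏Fin-* : ∀ k (f g : Fin k → Carrier) → ∏Fin R k (λ i → f i * g i) ≈ ∏Fin R k f * ∏Fin R k g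
  ∏Fin-* zero    f g = sym (*-identityˡ 1#)
  ∏Fin-* (suc k) f g = trans (*-congˡ (∏Fin-* k _ _)) (interchange _ _ _ _)

  lookupV-map : ∀ (h : A → B) (xs : Vec A k) i → lookupV R (map h xs) i ≡ h (lookupV R xs i)
  lookupV-map h (x ∷ xs) Fin.zero    = refl
  lookupV-map h (x ∷ xs) (Fin.suc i) = lookupV-map h xs i

  monomial : Matroid n → Carrier → Carrier → Subset n → Carrier
  monomial M u v S = u ^ corank M S * v ^ nullity M S

  term : Matroid n → (x y : Fin k → Carrier) → Vec (Subset n) k → Carrier
  term {k = k} M x y Ss = ∏Fin R k (λ i → monomial M (x i - 1#) (y i - 1#) (lookupV R Ss i))

  weight : Matroid n → (x y : Fin k → Carrier) → Vec (Subset n) k → Carrier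
  weight M x y Ss = term M x y Ss when does (isChain? Ss)

  Tutte≈∑weight : ∀ k (M : Matroid n) (x y : Fin k → Carrier) →
                  Tutte R k M x y ≈ ∑ (weight M x y) (allTuples k n)
  Tutte≈∑weight {n} k M x y = ∑-filter isChain? (term M x y) (allTuples k n)

  module _ {n₁ n₂ : ℕ} (M₁ : Matroid n₁) (M₂ : Matroid n₂) where

    monomial-⊕ : ∀ u v S → monomial (M₁ ⊕ M₂) u v S ≈
                 monomial M₁ u v (take n₁ S) * monomial M₂ u v (drop n₁ S)
    monomial-⊕ u v S = begin
      u ^ corank (M₁ ⊕ M₂) S * v ^ nullity (M₁ ⊕ M₂) S
        ≡⟨ cong₂ (λ p q → u ^ p * v ^ q) (corank-⊕ M₁ M₂ S) (nullity-⊕ M₁ M₂ S) ⟩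
      u ^ (c₁ ℕ.+ c₂) * v ^ (ν₁ ℕ.+ ν₂)
        ≈⟨ *-cong (^-homo-* u c₁ c₂) (^-homo-* v ν₁ ν₂) ⟩
      (u ^ c₁ * u ^ c₂) * (v ^ ν₁ * v ^ ν₂)
        ≈⟨ interchange _ _ _ _ ⟩
      (u ^ c₁ * v ^ ν₁) * (u ^ c₂ * v ^ ν₂) ∎
      where
      c₁ c₂ ν₁ ν₂ : ℕ
      c₁ = corank M₁ (take n₁ S)
      c₂ = corank M₂ (drop n₁ S)
      ν₁ = nullity M₁ (take n₁ S)
      ν₂ = nullity M₂ (drop n₁ S)

    term-⊕ : ∀ (x y : Fin k → Carrier) Ss →
             term (M₁ ⊕ M₂) x y Ss ≈ term M₁ x y (map (take n₁) Ss) * term M₂ x y (map (drop n₁) Ss)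
    term-⊕ {k} x y Ss = trans (∏Fin-cong k monomial-⊕-at) (∏Fin-* k _ _)
      where
      monomial-⊕-at : ∀ i → monomial (M₁ ⊕ M₂) (x i - 1#) (y i - 1#) (lookupV R Ss i) ≈
                      monomial M₁ (x i - 1#) (y i - 1#) (lookupV R (map (take n₁) Ss) i) *
                      monomial M₂ (x i - 1#) (y i - 1#) (lookupV R (map (drop n₁) Ss) i)
      monomial-⊕-at i rewrite lookupV-map (take n₁) Ss i | lookupV-map (drop n₁) Ss i =
        monomial-⊕ (x i - 1#) (y i - 1#) (lookupV R Ss i)

    weight-⊕ : ∀ (x y : Fin k → Carrier) Ss →
               weight (M₁ ⊕ M₂) x y Ss ≈ weight M₁ x y (map (take n₁) Ss) * weight M₂ x y (map (drop n₁) Ss)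
    weight-⊕ {k} x y Ss = begin
      term (M₁ ⊕ M₂) x y Ss when does (isChain? Ss)
        ≡⟨ cong (term (M₁ ⊕ M₂) x y Ss when_) (isChain?-take-drop n₁ Ss) ⟩
      term (M₁ ⊕ M₂) x y Ss when (does (isChain? Ss₁) ∧ does (isChain? Ss₂))
        ≈⟨ when-congˡ (does (isChain? Ss₁) ∧ does (isChain? Ss₂)) (term-⊕ x y Ss) ⟩
      (term M₁ x y Ss₁ * term M₂ x y Ss₂) when (does (isChain? Ss₁) ∧ does (isChain? Ss₂))
        ≈⟨ *-when-∧ _ _ (does (isChain? Ss₁)) (does (isChain? Ss₂)) ⟩
      weight M₁ x y Ss₁ * weight M₂ x y Ss₂ ∎
      where
      Ss₁ : Vec (Subset n₁) k
      Ss₁ = map (take n₁) Ss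
      Ss₂ : Vec (Subset n₂) k
      Ss₂ = map (drop n₁) Ss

proposition3p5 : {c ℓ : Level} (R : CommutativeRing c ℓ) {n₁ n₂ : ℕ}
    (M₁ : Matroid n₁) (M₂ : Matroid n₂) (k : ℕ) → 1 ≤ k →
    (x y : Fin k → CommutativeRing.Carrier R) →
    CommutativeRing._≈_ R (Tutte R k (M₁ ⊕ M₂) x y)
      (CommutativeRing._*_ R (Tutte R k M₁ x y) (Tutte R k M₂ x y))
proposition3p5 R {n₁} {n₂} M₁ M₂ k _ x y = begin
  Tutte R k (M₁ ⊕ M₂) x y
    ≈⟨ Tutte≈∑weight R k (M₁ ⊕ M₂) x y ⟩
  ∑ (weight R (M₁ ⊕ M₂) x y) (allTuples k (n₁ ℕ.+ n₂))
    ≈⟨ ∑-cong R (allTuples k (n₁ ℕ.+ n₂)) (weight-⊕ R M₁ M₂ x y) ⟩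
  ∑ (λ Ss → w₁ (map (take n₁) Ss) * w₂ (map (drop n₁) Ss)) (allTuples k (n₁ ℕ.+ n₂))
    ≈⟨ ∑-allTuples-take-drop R k n₁ n₂ (λ As Bs → w₁ As * w₂ Bs) ⟩
  ∑ (λ As → ∑ (λ Bs → w₁ As * w₂ Bs) (allTuples k n₂)) (allTuples k n₁)
    ≈⟨ ∑∑-* R w₁ w₂ (allTuples k n₁) (allTuples k n₂) ⟩
  ∑ w₁ (allTuples k n₁) * ∑ w₂ (allTuples k n₂)
    ≈⟨ *-cong (Tutte≈∑weight R k M₁ x y) (Tutte≈∑weight R k M₂ x y) ⟨
  Tutte R k M₁ x y * Tutte R k M₂ x y ∎
  where
  open CommutativeRing R using (Carrier; _*_; *-cong; setoid)
  open SetoidReasoning setoid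
  ∑ : {A : Set} → (A → Carrier) → List A → Carrier
  ∑ = ∑List R
  w₁ : Vec (Subset n₁) k → Carrier
  w₁ = weight R M₁ x y
  w₂ : Vec (Subset n₂) k → Carrier
  w₂ = weight R M₂ x y
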